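{- Let $n$ be a positive integer with $\gcd(n,6)=1$ and let $S=(x_1)(x_2)(x_3)(x_4)$ be a minimal zero-sum sequence over $\mathbb{Z}/n$ with integers $1\le x_i<n$. Suppose $\mathrm{ind}(S)=2$, $x_1=1$, $x_2+1=x_3$, and $\gcd(x_i,n)=1$ for all $i$. Let $f(k)=\left[\frac{3k-1}{3k}n\right]$. If $k$ is good and $x_2\ge f(k)$, then $x_2\ge f(2k)$.
   Context: $[\cdot]$ is the floor function. An integer $k$ is called good (relative to $n$) if: (i) $k=2^l$ for some integer $l\ge0$; (ii) $k<\frac{n}{6}$; (iii) $F(k):=\left(2n-2-2\left[\frac{3k-1}{3k}n\right]\right)k>\frac{n-1}{2}$. A sequence is minimal zero-sum if its terms sum to $0$ and no proper nontrivial subsequence sums to $0$. For a generator $g$ of $\mathbb{Z}/n$, writing $S=(y_1g)\cdots(y_4g)$ with $1\le y_i\le n$, the $g$-norm is $\|S\|_g=\frac{1}{n}\sum y_i$, and $\mathrm{ind}(S)=\min_g\|S\|_g$ over all generators $g$. -}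

module Defs where

open import Data.Nat using (ℕ; zero; suc; _+_; _*_; _∸_; _^_; _≤_; _<_; NonZero)
open import Data.Nat.DivMod using (_/_; _%_)
open import Data.Bool using (Bool; true; false)
open import Data.Fin using (Fin)
open import Data.Vec using (Vec; []; _∷_; lookup)
open import Data.Product using (Σ; ∃; _×_)
open import Data.Nat.GCD using (gcd)
open import Relation.Binary.PropositionalEquality using (_≡_)
open import Relation.Nullary using (¬_)
open import Data.Unit using (⊤)

CongMod : (n : ℕ) → .{{NonZero n}} → ℕ → ℕ → Set
CongMod n a b = a % n ≡ b % n

subSum : {m : ℕ} → Vec Bool m → Vec ℕ m → ℕ
subSum [] [] = 0
subSum (true ∷ bs) (x ∷ xs) = x + subSum bs xs
subSum (false ∷ bs) (x ∷ xs) = subSum bs xs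

vsum : {m : ℕ} → Vec ℕ m → ℕ
vsum [] = 0
vsum (x ∷ xs) = x + vsum xs

NontrivialProper : {m : ℕ} → Vec Bool m → Set
NontrivialProper {m} bs = (∃ λ (i : Fin m) → lookup bs i ≡ true) × (∃ λ (j : Fin m) → lookup bs j ≡ false)

MinimalZeroSum : (n : ℕ) → .{{NonZero n}} → {m : ℕ} → Vec ℕ m → Set
MinimalZeroSum n {m} xs =
  (CongMod n (vsum xs) 0) ×
  ((bs : Vec Bool m) → NontrivialProper bs → ¬ (CongMod n (subSum bs xs) 0))

Generator : (n : ℕ) → ℕ → Set
Generator n g = (g < n) × (gcd g n ≡ 1)

IsGCoeffs : (n : ℕ) → .{{NonZero n}} → ℕ → {m : ℕ} → Vec ℕ m → Vec ℕ m → Set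
IsGCoeffs n g [] [] = ⊤
IsGCoeffs n g (x ∷ xs) (y ∷ ys) = ((1 ≤ y) × (y ≤ n) × (CongMod n (y * g) x)) × IsGCoeffs n g xs ys

-- ind(S) = 2, i.e. min over generators g of ||S||_g = (1/n) Σ y_i equals 2,
-- expressed as: min over g of Σ y_i equals 2n.
IndexTwo : (n : ℕ) → .{{NonZero n}} → {m : ℕ} → Vec ℕ m → Set
IndexTwo n {m} xs =
  (Σ ℕ λ g → Generator n g × Σ (Vec ℕ m) λ ys → IsGCoeffs n g xs ys × vsum ys ≡ 2 * n) ×
  ((g : ℕ) → Generator n g → (ys : Vec ℕ m) → IsGCoeffs n g xs ys → 2 * n ≤ vsum ys)

-- f(k) = floor((3k-1) n / (3k)); value at k = 0 is junk (never used: good k ≥ 1)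
f : ℕ → ℕ → ℕ
f n zero = 0
f n (suc j) = ((3 * suc j ∸ 1) * n) / (3 * suc j)

-- F(k) = (2n - 2 - 2 f(k)) k   (the bracket is ≥ 0 since f(k) ≤ n - 1)
F : ℕ → ℕ → ℕ
F n k = (2 * n ∸ 2 ∸ 2 * f n k) * k

Good : ℕ → ℕ → Set
Good n k = (∃ λ l → k ≡ 2 ^ l) × (6 * k < n) × (n ∸ 1 < 2 * F n k)

-- With g the inverse of m modulo n and a = n - x₂, the sequence S = (1, x₂, x₂ + 1, x₄)
-- has g-coefficients (m, n - m a, n - m a + m, 2 m (a - 1) - n), which sum to n.
-- Hence ind(S) = 2 forbids every m coprime to n with m a < n < 2 m (a - 1).
-- If x₂ < f(2k), then m = 3k is such a multiplier unless 3k a ≥ n; in that case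
-- x₂ = f(k), and goodness of k makes m = 2k one. The upper bounds on n come out
-- non-strict and become strict because n is odd.
module Submission where

open import Defs
open import Data.Nat
open import Data.Nat.Properties
open import Data.Nat.DivMod
open import Data.Nat.Divisibility
open import Data.Nat.GCD using (gcd; module Bézout)
open import Data.Nat.Coprimality as Coprime
  using (Coprime; coprime⇒gcd≡1; gcd≡1⇒coprime; coprime-Bézout; coprime-divisor)
open import Data.Nat.Tactic.RingSolver using (solve)
open import Data.List.Base using () renaming ([] to ε; _∷_ to _,,_)
open import Data.Vec using (Vec; []; _∷_)
open import Data.Product using (∃-syntax; _×_; _,_)
open import Data.Empty using (⊥)
open import Data.Unit using (tt)
open import Function.Bundles using (_⇔_; mk⇔; Equivalence)
open import Relation.Binary.PropositionalEquality
open import Relation.Nullary using (¬_; yes; no; contradiction)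

-- From 1 + x m = y n, the inverse -x of m modulo n is represented by x (n - 1).
negated-inverse : ∀ m x y n .{{_ : NonZero n}} →
                  1 + x * m ≡ y * n → m * (x * pred n) + 1 * n ≡ 1 + y * pred n * n
negated-inverse m x y n@(suc p) 1+xm≡yn = begin
  m * (x * p) + 1 * n ≡⟨ solve (m ,, x ,, p ,, ε) ⟩
  1 + (1 + x * m) * p ≡⟨ cong (λ t → 1 + t * p) 1+xm≡yn ⟩
  1 + y * n * p       ≡⟨ solve (y ,, p ,, ε) ⟩
  1 + y * p * n       ∎
  where open ≡-Reasoning

module ModularArithmetic (n : ℕ) .{{_ : NonZero n}} where

  congMod-+ : ∀ {a b c d} → CongMod n a b → CongMod n c d → CongMod n (a + c) (b + d)
  congMod-+ {a} {b} {c} {d} a≡b c≡d = begin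
    (a + c) % n             ≡⟨ %-distribˡ-+ a c n ⟩
    (a % n + c % n) % n     ≡⟨ cong₂ (λ u v → (u + v) % n) a≡b c≡d ⟩
    (b % n + d % n) % n     ≡⟨ %-distribˡ-+ b d n ⟨
    (b + d) % n             ∎
    where open ≡-Reasoning

  congMod-* : ∀ {a b c d} → CongMod n a b → CongMod n c d → CongMod n (a * c) (b * d)
  congMod-* {a} {b} {c} {d} a≡b c≡d = begin
    (a * c) % n             ≡⟨ %-distribˡ-* a c n ⟩
    (a % n * (c % n)) % n   ≡⟨ cong₂ (λ u v → (u * v) % n) a≡b c≡d ⟩
    (b % n * (d % n)) % n   ≡⟨ %-distribˡ-* b d n ⟨
    (b * d) % n             ∎
    where open ≡-Reasoning

  congMod-+multiples : ∀ {a b} p q → a + p * n ≡ b + q * n → CongMod n a b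
  congMod-+multiples {a} {b} p q eq =
    trans (sym ([m+kn]%n≡m%n a p n)) (trans (cong (_% n) eq) ([m+kn]%n≡m%n b q n))

  coefficient-of-inverse : ∀ {m g x y} → CongMod n (m * g) 1 → CongMod n y (x * m) →
                           CongMod n (y * g) x
  coefficient-of-inverse {m} {g} {x} {y} mg≡1 y≡xm = begin
    (y * g) % n        ≡⟨ congMod-* y≡xm refl ⟩
    (x * m * g) % n    ≡⟨ cong (_% n) (*-assoc x m g) ⟩
    (x * (m * g)) % n  ≡⟨ congMod-* {x} refl mg≡1 ⟩
    (x * 1) % n        ≡⟨ cong (_% n) (*-identityʳ x) ⟩
    x % n              ∎
    where open ≡-Reasoning

  inverse⇒coprime : ∀ {m g} → CongMod n (m * g) 1 → Coprime g n
  inverse⇒coprime {m} {g} mg≡1 {d} (d∣g , d∣n) = ∣1⇒≡1 (∣n∣m%n⇒∣m d∣n d∣1%n)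
    where
    d∣1%n : d ∣ 1 % n
    d∣1%n = subst (d ∣_) mg≡1 (%-presˡ-∣ (∣n⇒∣m*n m d∣g) d∣n)

  ∃-inverse : ∀ {m} → Coprime m n → ∃[ g ] CongMod n (m * g) 1
  ∃-inverse {m} m⊥n with coprime-Bézout m⊥n
  ... | Bézout.+- x y 1+yn≡xm =
    x , congMod-+multiples 0 y (trans (+-identityʳ _) (trans (*-comm m x) (sym 1+yn≡xm)))
  ... | Bézout.-+ x y 1+xm≡yn =
    x * pred n , congMod-+multiples 1 (y * pred n) (negated-inverse m x y n 1+xm≡yn)

  inverse-generator : ∀ {m} → Coprime m n → ∃[ g ] Generator n g × CongMod n (m * g) 1
  inverse-generator {m} m⊥n with ∃-inverse m⊥n
  ... | g , mg≡1 =
    g % n , (m%n<n g n , coprime⇒gcd≡1 (inverse⇒coprime {m} m[g%n]≡1)) , m[g%n]≡1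
    where
    m[g%n]≡1 : CongMod n (m * (g % n)) 1
    m[g%n]≡1 = trans (congMod-* {m} refl (m%n%n≡m%n g n)) mg≡1

coprime-*ˡ : ∀ {a b n} → Coprime a n → Coprime b n → Coprime (a * b) n
coprime-*ˡ {a} a⊥n b⊥n {d} (d∣ab , d∣n) = b⊥n (coprime-divisor d⊥a d∣ab , d∣n)
  where
  d⊥a : Coprime d a
  d⊥a (e∣d , e∣a) = a⊥n (e∣a , ∣-trans e∣d d∣n)

coprime-^ˡ : ∀ {a n} l → Coprime a n → Coprime (a ^ l) n
coprime-^ˡ {n = n} zero    _   = Coprime.1-coprimeTo n
coprime-^ˡ         (suc l) a⊥n = coprime-*ˡ a⊥n (coprime-^ˡ l a⊥n)

coprime-∣ʳ : ∀ {m n d} → Coprime m n → d ∣ n → Coprime m d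
coprime-∣ʳ m⊥n d∣n (e∣m , e∣d) = m⊥n (e∣m , ∣-trans e∣d d∣n)

odd-≤⇒< : ∀ {n t} → ¬ 2 ∣ n → n ≤ 2 * t → n < 2 * t
odd-≤⇒< {t = t} n-odd n≤2t = ≤∧≢⇒< n≤2t (λ n≡2t → n-odd (divides t (trans n≡2t (*-comm 2 t))))

≤/⇔*≤ : ∀ {y N} d .{{_ : NonZero d}} → y ≤ N / d ⇔ y * d ≤ N
≤/⇔*≤ {y} {N} d = mk⇔
  (λ y≤N/d → ≤-trans (*-monoˡ-≤ d y≤N/d) (m/n*n≤m N d))
  (λ yd≤N → subst (_≤ N / d) (m*n/n≡m y d) (/-monoˡ-≤ d yd≤N))

≤f⇔ : ∀ {n y} k .{{_ : NonZero k}} → y ≤ f n k ⇔ 3 * k * y + n ≤ 3 * k * n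
≤f⇔ {n} {y} k@(suc _) = mk⇔ to from
  where
  open ≤-Reasoning
  d : ℕ
  d = 3 * k
  [d∸1]n+n : (d ∸ 1) * n + n ≡ d * n
  [d∸1]n+n = +-comm ((d ∸ 1) * n) n
  to : y ≤ f n k → d * y + n ≤ d * n
  to y≤fk = begin
    d * y + n       ≡⟨ cong (_+ n) (*-comm d y) ⟩
    y * d + n       ≤⟨ +-monoˡ-≤ n (Equivalence.to (≤/⇔*≤ d) y≤fk) ⟩
    (d ∸ 1) * n + n ≡⟨ [d∸1]n+n ⟩
    d * n           ∎
  from : d * y + n ≤ d * n → y ≤ f n k
  from dy+n≤dn = Equivalence.from (≤/⇔*≤ d) (+-cancelʳ-≤ n (y * d) ((d ∸ 1) * n) (begin
    y * d + n       ≡⟨ cong (_+ n) (*-comm y d) ⟩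
    d * y + n       ≤⟨ dy+n≤dn ⟩
    d * n           ≡⟨ [d∸1]n+n ⟨
    (d ∸ 1) * n + n ∎))

IndexAtLeastTwo : (n : ℕ) .{{_ : NonZero n}} {l : ℕ} → Vec ℕ l → Set
IndexAtLeastTwo n {l} xs =
  (g : ℕ) → Generator n g → (ys : Vec ℕ l) → IsGCoeffs n g xs ys → 2 * n ≤ vsum ys

module _ {n x x₄ : ℕ} .{{_ : NonZero n}}
         (zeroSum : CongMod n (vsum (1 ∷ x ∷ x + 1 ∷ x₄ ∷ [])) 0) where

  open ModularArithmetic n

  -- a = n - x is written suc b, so that y₂ = n - m a and y₄ = 2 m (a - 1) - n.
  module Coefficients {m g b y₂ y₄ : ℕ} (mg≡1 : CongMod n (m * g) 1) (x+a≡n : x + suc b ≡ n)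
                      (y₂+ma≡n : y₂ + m * suc b ≡ n) (y₄+n≡2mb : y₄ + n ≡ 2 * (m * b)) where

    open ≡-Reasoning

    coefficients-sum : vsum (m ∷ y₂ ∷ y₂ + m ∷ y₄ ∷ []) ≡ n
    coefficients-sum = +-cancelʳ-≡ _ _ n (begin
      m + (y₂ + (y₂ + m + (y₄ + 0))) + n ≡⟨ solve (m ,, y₂ ,, y₄ ,, n ,, ε) ⟩
      2 * m + 2 * y₂ + (y₄ + n)          ≡⟨ cong (2 * m + 2 * y₂ +_) y₄+n≡2mb ⟩
      2 * m + 2 * y₂ + 2 * (m * b)       ≡⟨ solve (m ,, y₂ ,, b ,, ε) ⟩
      2 * (y₂ + m * suc b)               ≡⟨ cong (2 *_) y₂+ma≡n ⟩
      2 * n                              ≡⟨ solve (n ,, ε) ⟩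
      n + n                              ∎)

    y₂≡xm : CongMod n y₂ (x * m)
    y₂≡xm = congMod-+multiples m 1 (begin
      y₂ + m * n               ≡⟨ cong (λ t → y₂ + m * t) x+a≡n ⟨
      y₂ + m * (x + suc b)     ≡⟨ solve (y₂ ,, m ,, x ,, b ,, ε) ⟩
      x * m + (y₂ + m * suc b) ≡⟨ cong (x * m +_) y₂+ma≡n ⟩
      x * m + n                ≡⟨ cong (x * m +_) (*-identityˡ n) ⟨
      x * m + 1 * n            ∎)

    y₃≡[x+1]m : CongMod n (y₂ + m) ((x + 1) * m)
    y₃≡[x+1]m = trans (congMod-+ {c = m} y₂≡xm refl) (cong (_% n) (solve (x ,, m ,, ε)))

    -- The zero sum gives x₄ ≡ -2 (x + 1), and y₄ = 2 m b - n ≡ -2 m (x + 1) as b = n - x - 1.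
    y₄≡x₄m : CongMod n y₄ (x₄ * m)
    y₄≡x₄m with m%n≡0⇒n∣m s n (trans zeroSum (m*n%n≡0 0 n))
      where
      s : ℕ
      s = vsum (1 ∷ x ∷ x + 1 ∷ x₄ ∷ [])
    ... | divides r s≡rn = congMod-+multiples (r * m + 1) (2 * m) (begin
      y₄ + (r * m + 1) * n                    ≡⟨ solve (y₄ ,, r ,, m ,, n ,, ε) ⟩
      (y₄ + n) + m * (r * n)                  ≡⟨ cong₂ (λ u v → u + m * v) y₄+n≡2mb (sym s≡rn) ⟩
      2 * (m * b) + m * (1 + (x + (x + 1 + (x₄ + 0)))) ≡⟨ solve (m ,, b ,, x ,, x₄ ,, ε) ⟩
      x₄ * m + 2 * m * (x + suc b)            ≡⟨ cong (λ t → x₄ * m + 2 * m * t) x+a≡n ⟩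
      x₄ * m + 2 * m * n                      ∎)

    coefficients : 1 ≤ m → 1 ≤ y₂ → 1 ≤ y₄ →
                   IsGCoeffs n g (1 ∷ x ∷ x + 1 ∷ x₄ ∷ []) (m ∷ y₂ ∷ y₂ + m ∷ y₄ ∷ [])
    coefficients 1≤m 1≤y₂ 1≤y₄ =
        (1≤m , m≤n , coefficient-of-inverse mg≡1 (cong (_% n) (sym (*-identityˡ m))))
      , (1≤y₂ , y₂≤n , coefficient-of-inverse mg≡1 y₂≡xm)
      , (≤-trans 1≤y₂ (m≤m+n y₂ m) , y₃≤n , coefficient-of-inverse mg≡1 y₃≡[x+1]m)
      , (1≤y₄ , y₄≤n , coefficient-of-inverse mg≡1 y₄≡x₄m)
      , tt
      where
      m≤n : m ≤ n
      m≤n = subst (m ≤_) coefficients-sum (m≤m+n m _)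
      y₂≤n : y₂ ≤ n
      y₂≤n = subst (y₂ ≤_) y₂+ma≡n (m≤m+n y₂ _)
      y₃≤n : y₂ + m ≤ n
      y₃≤n = subst (y₂ + m ≤_) y₂+ma≡n (+-monoʳ-≤ y₂ (m≤m*n m (suc b)))
      y₄≤n : y₄ ≤ n
      y₄≤n = subst (y₄ ≤_) coefficients-sum
        (≤-trans (m≤m+n y₄ 0) (≤-trans (m≤n+m _ (y₂ + m)) (≤-trans (m≤n+m _ y₂) (m≤n+m _ m))))

  no-multiplier-below-index-two : IndexAtLeastTwo n (1 ∷ x ∷ x + 1 ∷ x₄ ∷ []) →
    ∀ {m b} → Coprime m n → x + suc b ≡ n → m * suc b < n → n < 2 * (m * b) → ⊥
  no-multiplier-below-index-two _ {zero} _ _ _ ()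
  no-multiplier-below-index-two ind≥2 {m@(suc _)} {b} m⊥n x+a≡n ma<n n<2mb
    with inverse-generator m⊥n
  ... | g , g-gen , mg≡1 =
    <⇒≱ n<2n (subst (2 * n ≤_) coefficients-sum
                     (ind≥2 g g-gen _ (coefficients z<s 0<y₂ 0<y₄)))
    where
    open Coefficients {m} {g} mg≡1 x+a≡n (m∸n+n≡m (<⇒≤ ma<n)) (m∸n+n≡m (<⇒≤ n<2mb))
    0<y₂ : 0 < n ∸ m * suc b
    0<y₂ = m<n⇒0<n∸m ma<n
    0<y₄ : 0 < 2 * (m * b) ∸ n
    0<y₄ = m<n⇒0<n∸m n<2mb
    n<2n : n < 2 * n
    n<2n = subst (n <_) (*-comm n 2) (m<m*n n 2 ≤-refl)

module _ {n x b : ℕ} (x+a≡n : x + suc b ≡ n) (k : ℕ) .{{_ : NonZero k}} where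

  open ≤-Reasoning

  x<f[2k]⇒n≤6kb : x < f n (2 * k) → n ≤ 2 * (3 * k * b)
  x<f[2k]⇒n≤6kb x<f2k = +-cancelˡ-≤ (3 * (2 * k) * suc x) n _ (begin
    3 * (2 * k) * suc x + n               ≤⟨ Equivalence.to (≤f⇔ (2 * k) {{m*n≢0 2 k}}) x<f2k ⟩
    3 * (2 * k) * n                       ≡⟨ cong (3 * (2 * k) *_) x+a≡n ⟨
    3 * (2 * k) * (x + suc b)             ≡⟨ solve (k ,, x ,, b ,, ε) ⟩
    3 * (2 * k) * suc x + 2 * (3 * k * b) ∎)

  n≤3ka⇒x≤f[k] : n ≤ 3 * k * suc b → x ≤ f n k
  n≤3ka⇒x≤f[k] n≤3ka = Equivalence.from (≤f⇔ k) (begin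
    3 * k * x + n           ≤⟨ +-monoʳ-≤ (3 * k * x) n≤3ka ⟩
    3 * k * x + 3 * k * suc b ≡⟨ *-distribˡ-+ (3 * k) x (suc b) ⟨
    3 * k * (x + suc b)     ≡⟨ cong (3 * k *_) x+a≡n ⟩
    3 * k * n               ∎)

  f[k]≤x⇒2ka<n : f n k ≤ x → 6 * k < n → 2 * k * suc b < n
  f[k]≤x⇒2ka<n fk≤x 6k<n = *-cancelˡ-< 3 _ _ (begin-strict
    3 * (2 * k * suc b)     ≡⟨ solve (k ,, b ,, ε) ⟩
    2 * (3 * k * b) + 6 * k <⟨ +-mono-< (*-monoʳ-< 2 3kb<n) 6k<n ⟩
    2 * n + n               ≡⟨ solve (n ,, ε) ⟩
    3 * n                   ∎)
    where
    3kn<3k[x+1]+n : 3 * k * n < 3 * k * suc x + n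
    3kn<3k[x+1]+n = ≰⇒> (λ le → <⇒≱ (s≤s fk≤x) (Equivalence.from (≤f⇔ k) le))
    3kb<n : 3 * k * b < n
    3kb<n = +-cancelˡ-< (3 * k * suc x) _ _ (begin-strict
      3 * k * suc x + 3 * k * b ≡⟨ solve (k ,, x ,, b ,, ε) ⟩
      3 * k * (x + suc b)     ≡⟨ cong (3 * k *_) x+a≡n ⟩
      3 * k * n               <⟨ 3kn<3k[x+1]+n ⟩
      3 * k * suc x + n       ∎)

  2n∸2∸2x≡2b : 2 * n ∸ 2 ∸ 2 * x ≡ 2 * b
  2n∸2∸2x≡2b = begin-equality
    2 * n ∸ 2 ∸ 2 * x               ≡⟨ cong (λ t → 2 * t ∸ 2 ∸ 2 * x) x+a≡n ⟨
    2 * (x + suc b) ∸ 2 ∸ 2 * x     ≡⟨ cong (λ t → t ∸ 2 ∸ 2 * x) 2[x+a]≡2+2x+2b ⟩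
    2 + (2 * x + 2 * b) ∸ 2 ∸ 2 * x ≡⟨ cong (_∸ 2 * x) (m+n∸m≡n 2 (2 * x + 2 * b)) ⟩
    2 * x + 2 * b ∸ 2 * x           ≡⟨ m+n∸m≡n (2 * x) (2 * b) ⟩
    2 * b                           ∎
    where
    2[x+a]≡2+2x+2b : 2 * (x + suc b) ≡ 2 + (2 * x + 2 * b)
    2[x+a]≡2+2x+2b = solve (x ,, b ,, ε)

  F[k]≡2kb : x ≡ f n k → F n k ≡ 2 * k * b
  F[k]≡2kb x≡fk = begin-equality
    (2 * n ∸ 2 ∸ 2 * f n k) * k ≡⟨ cong (λ t → (2 * n ∸ 2 ∸ 2 * t) * k) x≡fk ⟨
    (2 * n ∸ 2 ∸ 2 * x) * k     ≡⟨ cong (_* k) 2n∸2∸2x≡2b ⟩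
    2 * b * k                   ≡⟨ 2bk≡2kb ⟩
    2 * k * b                   ∎
    where
    2bk≡2kb : 2 * b * k ≡ 2 * k * b
    2bk≡2kb = solve (b ,, k ,, ε)

  n∸1<2F[k]⇒n≤4kb : .{{_ : NonZero n}} → x ≡ f n k → n ∸ 1 < 2 * F n k →
                    n ≤ 2 * (2 * k * b)
  n∸1<2F[k]⇒n≤4kb x≡fk n∸1<2Fk = begin
    n                 ≡⟨ suc-pred n ⟨
    suc (n ∸ 1)       ≤⟨ n∸1<2Fk ⟩
    2 * F n k         ≡⟨ cong (2 *_) (F[k]≡2kb x≡fk) ⟩
    2 * (2 * k * b)   ∎

lemma5 : (n : ℕ) → .{{_ : NonZero n}} → gcd n 6 ≡ 1 →
    (x₁ x₂ x₃ x₄ : ℕ) →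
    1 ≤ x₁ → x₁ < n → 1 ≤ x₂ → x₂ < n → 1 ≤ x₃ → x₃ < n → 1 ≤ x₄ → x₄ < n →
    MinimalZeroSum n (x₁ ∷ x₂ ∷ x₃ ∷ x₄ ∷ []) →
    IndexTwo n (x₁ ∷ x₂ ∷ x₃ ∷ x₄ ∷ []) →
    x₁ ≡ 1 → x₂ + 1 ≡ x₃ →
    gcd x₁ n ≡ 1 → gcd x₂ n ≡ 1 → gcd x₃ n ≡ 1 → gcd x₄ n ≡ 1 →
    (k : ℕ) → Good n k → f n k ≤ x₂ → f n (2 * k) ≤ x₂
lemma5 n gcd[n,6]≡1 .1 x .(x + 1) x₄ _ _ _ x<n _ _ _ _ (zeroSum , _) (_ , index≥2) refl refl _ _ _ _
       k ((l , refl) , 6k<n , n∸1<2Fk) fk≤x = ≮⇒≥ x≮f[2k]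
  where
  instance
    k≢0 : NonZero k
    k≢0 = m^n≢0 2 l
  n⊥6 : Coprime n 6
  n⊥6 = gcd≡1⇒coprime gcd[n,6]≡1
  2⊥n : Coprime 2 n
  2⊥n = Coprime.sym (coprime-∣ʳ n⊥6 (divides 3 refl))
  3⊥n : Coprime 3 n
  3⊥n = Coprime.sym (coprime-∣ʳ n⊥6 (divides 2 refl))
  n-odd : ¬ 2 ∣ n
  n-odd 2∣n = contradiction (2⊥n (∣-refl , 2∣n)) λ ()
  b : ℕ
  b = n ∸ suc x
  x+a≡n : x + suc b ≡ n
  x+a≡n = trans (+-suc x b) (m+[n∸m]≡n x<n)
  x≮f[2k] : x < f n (2 * k) → ⊥
  x≮f[2k] x<f[2k] with 3 * k * suc b <? n
  ... | yes 3ka<n = no-multiplier-below-index-two zeroSum index≥2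
        (coprime-*ˡ 3⊥n (coprime-^ˡ l 2⊥n)) x+a≡n 3ka<n
        (odd-≤⇒< {t = 3 * k * b} n-odd (x<f[2k]⇒n≤6kb x+a≡n k x<f[2k]))
  ... | no 3ka≮n = no-multiplier-below-index-two zeroSum index≥2
        (coprime-^ˡ (suc l) 2⊥n) x+a≡n (f[k]≤x⇒2ka<n x+a≡n k fk≤x 6k<n)
        (odd-≤⇒< {t = 2 * k * b} n-odd (n∸1<2F[k]⇒n≤4kb x+a≡n k x≡fk n∸1<2Fk))
    where
    x≡fk : x ≡ f n k
    x≡fk = ≤-antisym (n≤3ka⇒x≤f[k] x+a≡n k (≮⇒≥ 3ka≮n)) fk≤x
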